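{- Let $\mathcal F\subseteq\mathcal P([n])$ be a diamond-saturated family with $\emptyset,[n]\notin\mathcal F$, let $\mathcal A$ be the set of minimal elements and $\mathcal X$ the set of maximal elements of $\mathcal F$. If $|\mathcal F|<\frac{3n}{2}$, then $\mathcal A\cap\mathcal X=\emptyset$.
   Context: $\mathcal P([n])$ is the power set of $[n]=\{1,\dots,n\}$ ordered by inclusion. An induced diamond is four distinct sets $D,P,Q,T$ with $D\subsetneq P\subsetneq T$, $D\subsetneq Q\subsetneq T$ and $P,Q$ incomparable. $\mathcal F$ is diamond-saturated if it contains no induced diamond but $\mathcal F\cup\{S\}$ contains one for every $S\in\mathcal P([n])\setminus\mathcal F$. Minimal/maximal elements are with respect to inclusion. -}

module Defs where

open import Data.Nat using (ℕ)
open import Data.Fin.Subset using (Subset; _⊆_; _⊂_; ⊥; ⊤)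
open import Data.List using (List; _∷_)
open import Data.List.Membership.Propositional using (_∈_; _∉_)
open import Data.List.Relation.Unary.Unique.Propositional using (Unique)
open import Data.Product using (_×_; ∃)
open import Relation.Binary.PropositionalEquality using (_≡_)
open import Relation.Nullary using (¬_)

-- A finite family of subsets of [n], given as a duplicate-free list of subsets
-- (a subset of [n] is Data.Fin.Subset's Subset n = Vec Bool n; ⊆, ⊂ are inclusion
-- and strict inclusion).

Incomparable : ∀ {n} → Subset n → Subset n → Set
Incomparable P Q = ¬ (P ⊆ Q) × ¬ (Q ⊆ P)

-- An induced diamond on D, P, Q, T (distinctness of the four sets follows)
IsDiamond : ∀ {n} → Subset n → Subset n → Subset n → Subset n → Set
IsDiamond D P Q T = D ⊂ P × P ⊂ T × D ⊂ Q × Q ⊂ T × Incomparable P Q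

HasDiamond : ∀ {n} → List (Subset n) → Set
HasDiamond {n} F =
  ∃ λ (D : Subset n) → ∃ λ (P : Subset n) → ∃ λ (Q : Subset n) → ∃ λ (T : Subset n) →
    D ∈ F × P ∈ F × Q ∈ F × T ∈ F × IsDiamond D P Q T

DiamondSaturated : ∀ {n} → List (Subset n) → Set
DiamondSaturated {n} F =
  ¬ HasDiamond F × ((S : Subset n) → S ∉ F → HasDiamond (S ∷ F))

IsMinimal : ∀ {n} → List (Subset n) → Subset n → Set
IsMinimal {n} F A = A ∈ F × ((B : Subset n) → B ∈ F → B ⊆ A → B ≡ A)

IsMaximal : ∀ {n} → List (Subset n) → Subset n → Set
IsMaximal {n} F X = X ∈ F × ((B : Subset n) → B ∈ F → X ⊆ B → B ≡ X)

-- Let S be both minimal and maximal in F. For every i ∈ [n] the neighbour N of S obtained by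
-- toggling i is comparable with S, hence not in F, so adding it creates a diamond. Since S is
-- isolated, nothing of F lies below S ∖ {i} (resp. above S ∪ {i}), so N is the bottom (resp. top)
-- of that diamond, and its other three sets are members Y of F for which i is the only element
-- of S missing from Y (resp. the only element of Y outside S). A fixed Y is such a witness for at
-- most one i of each kind, so the three witnesses of each i embed [n] × 3 into F × 2.
module Submission where

open import Defs
open import Data.Nat using (ℕ; _*_; _<_)
open import Data.Fin.Subset using (Subset; ⊥; ⊤)
open import Data.List using (List; length)
open import Data.List.Membership.Propositional using (_∉_)
open import Data.List.Relation.Unary.Unique.Propositional using (Unique)
open import Data.Product using (_×_)
open import Relation.Nullary using (¬_)

open import Data.Nat using (_≤_)
open import Data.Nat.Properties using (*-comm; <⇒≱)
open import Data.Fin using (Fin; zero; suc; _≟_)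
open import Data.Fin.Properties using (injective⇒≤; *↔×)
open import Data.Fin.Subset using (_⊆_; _⊈_; _⊂_; _∪_; ⁅_⁆; _-_)
  renaming (_∈_ to _∈ₛ_; _∉_ to _∉ₛ_)
open import Data.Fin.Subset.Properties
  using (_∈?_; ⊆-refl; ⊆-trans; ⊂-trans; ⊂-irref; p⊂q⇒p⊆q; ⊂-⊆-trans; p─q⊆p; x∈p⇒p-x⊂p;
         x∈p∧x∉q⇒x∈p─q; x≢y⇒x∉⁅y⁆; x∈⁅x⁆; x∈⁅y⁆⇒x≡y; p⊆p∪q; x∈p∪q⁻; x∈p∪q⁺)
open import Data.List using (_∷_)
open import Data.List.Membership.Propositional using (_∈_)
open import Data.List.Membership.Setoid.Properties using (index-injective)
open import Data.List.Relation.Unary.Any as Any using (here; there)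
open import Data.Vec using (Vec; []; _∷_; lookup)
open import Data.Vec.Relation.Unary.All using (All; []; _∷_)
open import Data.Vec.Relation.Unary.All.Properties using (lookup⁺)
import Data.Vec.Relation.Unary.Unique.Propositional as Vec
open import Data.Vec.Relation.Unary.AllPairs using ([]; _∷_)
open import Data.Vec.Relation.Unary.Unique.Propositional.Properties using (lookup-injective)
open import Data.Product using (_,_; proj₁; proj₂; ∃; ∃₂)
open import Data.Product.Properties using (,-injective)
open import Data.Sum using (_⊎_; inj₁; inj₂; [_,_]′)
open import Data.Empty using (⊥-elim)
open import Function using (Injective; _↣_; mk↣)
open import Function.Construct.Composition using (_↣-∘_)
open import Function.Properties.Inverse using (↔⇒↣; ↔-sym)
open import Function.Bundles using (Injection)
open import Relation.Nullary using (yes; no; contradiction)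
open import Relation.Binary.PropositionalEquality using (_≡_; _≢_; refl; sym; cong; subst; subst₂; setoid)

private
  variable
    n : ℕ
    i j : Fin n
    p q Y : Subset n

↣⇒*≤* : ∀ {m k l} → (Fin m × Fin k) ↣ (Fin n × Fin l) → m * k ≤ n * l
↣⇒*≤* f = injective⇒≤ (Injection.injective (↔⇒↣ (↔-sym *↔×) ↣-∘ (f ↣-∘ ↔⇒↣ *↔×)))

p⊂q⇒q⊈p : p ⊂ q → q ⊈ p
p⊂q⇒q⊈p p⊂q q⊆p = ⊂-irref refl (⊂-⊆-trans p⊂q q⊆p)

x∈p⇒x≡y⊎x∈p-y : ∀ {x} y → x ∈ₛ p → x ≡ y ⊎ x ∈ₛ p - y
x∈p⇒x≡y⊎x∈p-y {x = x} y x∈p with x ≟ y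
... | yes x≡y = inj₁ x≡y
... | no  x≢y = inj₂ (x∈p∧x∉q⇒x∈p─q x∈p (x≢y⇒x∉⁅y⁆ x≢y))

x∉p⇒p⊂p∪⁅x⁆ : ∀ {x} → x ∉ₛ p → p ⊂ p ∪ ⁅ x ⁆
x∉p⇒p⊂p∪⁅x⁆ {x = x} x∉p = p⊆p∪q ⁅ x ⁆ , x , x∈p∪q⁺ (inj₂ (x∈⁅x⁆ x)) , x∉p

MissesOnly : Subset n → Fin n → Subset n → Set
MissesOnly S i Y = i ∈ₛ S × i ∉ₛ Y × S - i ⊆ Y

AddsOnly : Subset n → Fin n → Subset n → Set
AddsOnly S i Y = i ∉ₛ S × i ∈ₛ Y × Y ⊆ S ∪ ⁅ i ⁆

MissesOnly-unique : ∀ {S} → MissesOnly S i Y → MissesOnly S j Y → i ≡ j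
MissesOnly-unique {i = i} (_ , _ , S-i⊆Y) (j∈S , j∉Y , _) with x∈p⇒x≡y⊎x∈p-y i j∈S
... | inj₁ j≡i   = sym j≡i
... | inj₂ j∈S-i = contradiction (S-i⊆Y j∈S-i) j∉Y

AddsOnly-unique : ∀ {S} → AddsOnly S i Y → AddsOnly S j Y → i ≡ j
AddsOnly-unique {i = i} {S = S} (_ , _ , Y⊆S∪i) (j∉S , j∈Y , _) with x∈p∪q⁻ S ⁅ i ⁆ (Y⊆S∪i j∈Y)
... | inj₁ j∈S = contradiction j∈S j∉S
... | inj₂ j∈i = sym (x∈⁅y⁆⇒x≡y i j∈i)

Witness : Subset n → Fin n → Subset n → Set
Witness S i Y = MissesOnly S i Y ⊎ AddsOnly S i Y

side : ∀ {S} → Witness S i Y → Fin 2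
side (inj₁ _) = zero
side (inj₂ _) = suc zero

Witness-unique : ∀ {S Y′} (a : Witness S i Y) (b : Witness S j Y′) →
                 Y ≡ Y′ → side a ≡ side b → i ≡ j
Witness-unique (inj₁ a) (inj₁ b) refl _ = MissesOnly-unique a b
Witness-unique (inj₂ a) (inj₂ b) refl _ = AddsOnly-unique a b
Witness-unique (inj₁ _) (inj₂ _) _ ()
Witness-unique (inj₂ _) (inj₁ _) _ ()

tops-distinct : ∀ {D P Q T : Subset n} → IsDiamond D P Q T → Vec.Unique (P ∷ Q ∷ T ∷ [])
tops-distinct (_ , P⊂T , _ , Q⊂T , P⊈Q , _) =
    ((λ { refl → P⊈Q ⊆-refl }) ∷ (λ P≡T → ⊂-irref P≡T P⊂T) ∷ [])
  ∷ ((λ Q≡T → ⊂-irref Q≡T Q⊂T) ∷ [])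
  ∷ []
  ∷ []

bottoms-distinct : ∀ {D P Q T : Subset n} → IsDiamond D P Q T → Vec.Unique (D ∷ P ∷ Q ∷ [])
bottoms-distinct (D⊂P , _ , D⊂Q , _ , P⊈Q , _) =
    ((λ D≡P → ⊂-irref D≡P D⊂P) ∷ (λ D≡Q → ⊂-irref D≡Q D⊂Q) ∷ [])
  ∷ ((λ { refl → P⊈Q ⊆-refl }) ∷ [])
  ∷ []
  ∷ []

module _ {F : List (Subset n)} (sat : DiamondSaturated F) {N : Subset n} where

  diamond-with-bottom : (∀ {Y} → Y ∈ F → Y ⊈ N) →
    ∃₂ λ P Q → ∃ λ T → P ∈ F × Q ∈ F × T ∈ F × IsDiamond N P Q T
  diamond-with-bottom nothing-below with proj₂ sat N (λ N∈F → nothing-below N∈F ⊆-refl)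
  ... | _ , P , Q , T , here refl , P∈ , Q∈ , T∈ , dia@(N⊂P , P⊂T , N⊂Q , _) =
    P , Q , T , above N⊂P P∈ , above N⊂Q Q∈ , above (⊂-trans N⊂P P⊂T) T∈ , dia
    where
    above : ∀ {X} → N ⊂ X → X ∈ N ∷ F → X ∈ F
    above N⊂X = Any.tail λ X≡N → ⊂-irref (sym X≡N) N⊂X
  ... | D , P , Q , T , there D∈F , P∈ , Q∈ , T∈ , dia@(D⊂P , P⊂T , D⊂Q , _) =
    ⊥-elim (proj₁ sat (D , P , Q , T , D∈F , old D⊂P P∈ , old D⊂Q Q∈ , old (⊂-trans D⊂P P⊂T) T∈ , dia))
    where
    old : ∀ {X} → D ⊂ X → X ∈ N ∷ F → X ∈ F
    old D⊂X = Any.tail λ { refl → nothing-below D∈F (p⊂q⇒p⊆q D⊂X) }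

  diamond-with-top : (∀ {Y} → Y ∈ F → N ⊈ Y) →
    ∃₂ λ D P → ∃ λ Q → D ∈ F × P ∈ F × Q ∈ F × IsDiamond D P Q N
  diamond-with-top nothing-above with proj₂ sat N (λ N∈F → nothing-above N∈F ⊆-refl)
  ... | D , P , Q , _ , D∈ , P∈ , Q∈ , here refl , dia@(D⊂P , P⊂N , _ , Q⊂N , _) =
    D , P , Q , below (⊂-trans D⊂P P⊂N) D∈ , below P⊂N P∈ , below Q⊂N Q∈ , dia
    where
    below : ∀ {X} → X ⊂ N → X ∈ N ∷ F → X ∈ F
    below X⊂N = Any.tail λ X≡N → ⊂-irref X≡N X⊂N
  ... | D , P , Q , T , D∈ , P∈ , Q∈ , there T∈F , dia@(D⊂P , P⊂T , _ , Q⊂T , _) =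
    ⊥-elim (proj₁ sat (D , P , Q , T , old (⊂-trans D⊂P P⊂T) D∈ , old P⊂T P∈ , old Q⊂T Q∈ , T∈F , dia))
    where
    old : ∀ {X} → X ⊂ T → X ∈ N ∷ F → X ∈ F
    old X⊂T = Any.tail λ { refl → nothing-above T∈F (p⊂q⇒p⊆q X⊂T) }

module Isolated {F : List (Subset n)} {S : Subset n} (sat : DiamondSaturated F)
                (minimal : IsMinimal F S) (maximal : IsMaximal F S) where

  ⊆S⇒≡S : Y ∈ F → Y ⊆ S → Y ≡ S
  ⊆S⇒≡S = proj₂ minimal _

  ⊇S⇒≡S : Y ∈ F → S ⊆ Y → Y ≡ S
  ⊇S⇒≡S = proj₂ maximal _

  below-member⇒≢S : ∀ {Z} → Z ∈ F → Y ⊂ Z → Y ≢ S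
  below-member⇒≢S Z∈F S⊂Z refl = ⊂-irref (sym (⊇S⇒≡S Z∈F (p⊂q⇒p⊆q S⊂Z))) S⊂Z

  above-member⇒≢S : ∀ {Z} → Y ∈ F → Y ⊂ Z → Z ≢ S
  above-member⇒≢S Y∈F Y⊂S refl = ⊂-irref (⊆S⇒≡S Y∈F (p⊂q⇒p⊆q Y⊂S)) Y⊂S

  ⊇S-i⇒MissesOnly : i ∈ₛ S → Y ∈ F → S - i ⊆ Y → Y ≢ S → MissesOnly S i Y
  ⊇S-i⇒MissesOnly {i = i} {Y = Y} i∈S Y∈F S-i⊆Y Y≢S = i∈S , i∉Y , S-i⊆Y
    where
    i∉Y : i ∉ₛ Y
    i∉Y i∈Y = Y≢S (⊇S⇒≡S Y∈F S⊆Y)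
      where
      S⊆Y : S ⊆ Y
      S⊆Y x∈S = [ (λ x≡i → subst (_∈ₛ Y) (sym x≡i) i∈Y) , S-i⊆Y ]′ (x∈p⇒x≡y⊎x∈p-y i x∈S)

  ⊆S∪i⇒AddsOnly : i ∉ₛ S → Y ∈ F → Y ⊆ S ∪ ⁅ i ⁆ → Y ≢ S → AddsOnly S i Y
  ⊆S∪i⇒AddsOnly {i = i} {Y = Y} i∉S Y∈F Y⊆S∪i Y≢S with i ∈? Y
  ... | yes i∈Y = i∉S , i∈Y , Y⊆S∪i
  ... | no  i∉Y = ⊥-elim (Y≢S (⊆S⇒≡S Y∈F Y⊆S))
    where
    Y⊆S : Y ⊆ S
    Y⊆S x∈Y = [ (λ x∈S → x∈S) , (λ x∈i → contradiction (subst (_∈ₛ Y) (x∈⁅y⁆⇒x≡y i x∈i) x∈Y) i∉Y) ]′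
                (x∈p∪q⁻ S ⁅ i ⁆ (Y⊆S∪i x∈Y))

  nothing-below-S-i : i ∈ₛ S → Y ∈ F → Y ⊈ S - i
  nothing-below-S-i {i = i} i∈S Y∈F Y⊆S-i = p⊂q⇒q⊈p (x∈p⇒p-x⊂p i∈S)
    (subst (_⊆ S - i) (⊆S⇒≡S Y∈F (⊆-trans Y⊆S-i (p─q⊆p S ⁅ i ⁆))) Y⊆S-i)

  nothing-above-S∪i : i ∉ₛ S → Y ∈ F → S ∪ ⁅ i ⁆ ⊈ Y
  nothing-above-S∪i {i = i} i∉S Y∈F S∪i⊆Y = p⊂q⇒q⊈p (x∉p⇒p⊂p∪⁅x⁆ i∉S)
    (subst (S ∪ ⁅ i ⁆ ⊆_) (⊇S⇒≡S Y∈F (⊆-trans (p⊆p∪q ⁅ i ⁆) S∪i⊆Y)) S∪i⊆Y)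

  record Witnesses (i : Fin n) : Set where
    field
      sets     : Vec (Subset n) 3
      distinct : Vec.Unique sets
      members  : All (_∈ F) sets
      witness : All (Witness S i) sets

  witnesses-missing : i ∈ₛ S → Witnesses i
  witnesses-missing {i = i} i∈S with diamond-with-bottom sat (nothing-below-S-i i∈S)
  ... | P , Q , T , P∈ , Q∈ , T∈ , dia@(N⊂P , P⊂T , N⊂Q , Q⊂T , _) = record
    { sets     = P ∷ Q ∷ T ∷ []
    ; distinct = tops-distinct dia
    ; members  = P∈ ∷ Q∈ ∷ T∈ ∷ []
    ; witness = inj₁ (⊇S-i⇒MissesOnly i∈S P∈ (p⊂q⇒p⊆q N⊂P) (below-member⇒≢S T∈ P⊂T))
               ∷ inj₁ (⊇S-i⇒MissesOnly i∈S Q∈ (p⊂q⇒p⊆q N⊂Q) (below-member⇒≢S T∈ Q⊂T))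
               ∷ inj₁ (⊇S-i⇒MissesOnly i∈S T∈ (p⊂q⇒p⊆q (⊂-trans N⊂P P⊂T)) (above-member⇒≢S P∈ P⊂T))
               ∷ []
    }

  witnesses-adding : i ∉ₛ S → Witnesses i
  witnesses-adding {i = i} i∉S with diamond-with-top sat (nothing-above-S∪i i∉S)
  ... | D , P , Q , D∈ , P∈ , Q∈ , dia@(D⊂P , P⊂N , D⊂Q , Q⊂N , _) = record
    { sets     = D ∷ P ∷ Q ∷ []
    ; distinct = bottoms-distinct dia
    ; members  = D∈ ∷ P∈ ∷ Q∈ ∷ []
    ; witness = inj₂ (⊆S∪i⇒AddsOnly i∉S D∈ (p⊂q⇒p⊆q (⊂-trans D⊂P P⊂N)) (below-member⇒≢S P∈ D⊂P))
               ∷ inj₂ (⊆S∪i⇒AddsOnly i∉S P∈ (p⊂q⇒p⊆q P⊂N) (above-member⇒≢S D∈ D⊂P))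
               ∷ inj₂ (⊆S∪i⇒AddsOnly i∉S Q∈ (p⊂q⇒p⊆q Q⊂N) (above-member⇒≢S D∈ D⊂Q))
               ∷ []
    }

  witnesses : (i : Fin n) → Witnesses i
  witnesses i with i ∈? S
  ... | yes i∈S = witnesses-missing i∈S
  ... | no  i∉S = witnesses-adding i∉S

  open Witnesses

  embedding : (Fin n × Fin 3) ↣ (Fin (length F) × Fin 2)
  embedding = mk↣ embed-injective
    where
    member : ∀ i k → lookup (sets (witnesses i)) k ∈ F
    member i k = lookup⁺ (members (witnesses i)) k

    witness-of : ∀ i k → Witness S i (lookup (sets (witnesses i)) k)
    witness-of i k = lookup⁺ (witness (witnesses i)) k

    embed : Fin n × Fin 3 → Fin (length F) × Fin 2
    embed (i , k) = Any.index (member i k) , side (witness-of i k)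

    embed-injective : Injective _≡_ _≡_ embed
    embed-injective {i , k} {j , l} eq
      with index≡ , side≡ ← ,-injective eq
      with Y≡ ← index-injective (setoid _) (member i k) (member j l) index≡
      with refl ← Witness-unique (witness-of i k) (witness-of j l) Y≡ side≡
      = cong (i ,_) (lookup-injective (distinct (witnesses i)) k l Y≡)

proposition4p1 : (n : ℕ) (F : List (Subset n)) → Unique F → DiamondSaturated F →
    ⊥ ∉ F → ⊤ ∉ F → 2 * length F < 3 * n →
    (S : Subset n) → ¬ (IsMinimal F S × IsMaximal F S)
proposition4p1 n F _ sat _ _ 2∣F∣<3n S (minimal , maximal) =
  <⇒≱ 2∣F∣<3n (subst₂ _≤_ (*-comm n 3) (*-comm (length F) 2) 3n≤2∣F∣)
  where
  3n≤2∣F∣ : n * 3 ≤ length F * 2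
  3n≤2∣F∣ = ↣⇒*≤* (Isolated.embedding sat minimal maximal)
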